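{- Assume the Python floating-point type is identified with $\mathbb{R}$. For every term $\theta$ and every state $\nu$: if the compiled Python expression $\mathrm{Py}(\theta)$ evaluates in $\nu$ to the value $u$, then the real value of $\theta$ in state $\nu$ equals $u$.
   Context: Terms are built from number literals, variables, unary minus, and the binary operations $+,-,\cdot,/$ and exponentiation $\theta^\eta$; a state $\nu$ maps variables to reals and the value of a term in $\nu$ is computed by real arithmetic. The compilation $\mathrm{Py}$ maps a literal $z$ to the Python literal \texttt{z}, a variable $x$ to the Python variable \texttt{x}, and $-\theta,\ \theta+\eta,\ \theta-\eta,\ \theta\cdot\eta,\ \theta/\eta,\ \theta^\eta$ to \texttt{ - }$\mathrm{Py}(\theta)$, $\mathrm{Py}(\theta)$\texttt{+}$\mathrm{Py}(\eta)$, $\mathrm{Py}(\theta)$\texttt{ - }$\mathrm{Py}(\eta)$, $\mathrm{Py}(\theta)$\texttt{*}$\mathrm{Py}(\eta)$, $\mathrm{Py}(\theta)$\texttt{/}$\mathrm{Py}(\eta)$, $\mathrm{Py}(\theta)$\texttt{**}$\mathrm{Py}(\eta)$ respectively. Python states are restricted to stacks mapping variables to (real) values, identified with the states above. Python expression evaluation: a literal evaluates to itself, a variable \texttt{x} to $\nu(x)$, and \texttt{ - }$e$, $e$\texttt{+}$e'$, $e$\texttt{ - }$e'$, $e$\texttt{*}$e'$, $e$\texttt{/}$e'$, $e$\texttt{**}$e'$ evaluate to the negation, sum, difference, product, quotient and power of the values of their subexpressions, respectively. -}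

module Defs where

open import Data.Nat using (ℕ)
open import Relation.Binary.PropositionalEquality using (_≡_)

-- We abstract over a carrier "ℝ" equipped with
-- the real-arithmetic operations used by the terms (negation, +, -, *, /, power).
-- Python floats are identified with this same carrier and Python's operators
-- are interpreted by these same operations (the paper's identification float = ℝ).
record RealArith : Set₁ where
  field
    ℝ    : Set
    neg  : ℝ → ℝ
    add  : ℝ → ℝ → ℝ
    sub  : ℝ → ℝ → ℝ
    mul  : ℝ → ℝ → ℝ
    div  : ℝ → ℝ → ℝ
    pow  : ℝ → ℝ → ℝ

Var : Set
Var = ℕ

module _ (R : RealArith) where
  open RealArith R

  data Term : Set where
    lit   : ℝ → Term
    var   : Var → Term
    ⊖_    : Term → Term
    _⊕_   : Term → Term → Term
    _⊝_   : Term → Term → Term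
    _⊛_   : Term → Term → Term
    _⊘_   : Term → Term → Term
    _^ᵗ_  : Term → Term → Term

  State : Set
  State = Var → ℝ

  ⟦_⟧_ : Term → State → ℝ
  ⟦ lit z ⟧ ν = z
  ⟦ var x ⟧ ν = ν x
  ⟦ ⊖ θ ⟧ ν = neg (⟦ θ ⟧ ν)
  ⟦ θ ⊕ η ⟧ ν = add (⟦ θ ⟧ ν) (⟦ η ⟧ ν)
  ⟦ θ ⊝ η ⟧ ν = sub (⟦ θ ⟧ ν) (⟦ η ⟧ ν)
  ⟦ θ ⊛ η ⟧ ν = mul (⟦ θ ⟧ ν) (⟦ η ⟧ ν)
  ⟦ θ ⊘ η ⟧ ν = div (⟦ θ ⟧ ν) (⟦ η ⟧ ν)
  ⟦ θ ^ᵗ η ⟧ ν = pow (⟦ θ ⟧ ν) (⟦ η ⟧ ν)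

  data PyExpr : Set where
    pyLit  : ℝ → PyExpr
    pyVar  : Var → PyExpr
    pyNeg  : PyExpr → PyExpr
    pyAdd  : PyExpr → PyExpr → PyExpr
    pySub  : PyExpr → PyExpr → PyExpr
    pyMul  : PyExpr → PyExpr → PyExpr
    pyDiv  : PyExpr → PyExpr → PyExpr
    pyPow  : PyExpr → PyExpr → PyExpr

  Py : Term → PyExpr
  Py (lit z) = pyLit z
  Py (var x) = pyVar x
  Py (⊖ θ) = pyNeg (Py θ)
  Py (θ ⊕ η) = pyAdd (Py θ) (Py η)
  Py (θ ⊝ η) = pySub (Py θ) (Py η)
  Py (θ ⊛ η) = pyMul (Py θ) (Py η)
  Py (θ ⊘ η) = pyDiv (Py θ) (Py η)
  Py (θ ^ᵗ η) = pyPow (Py θ) (Py η)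

  data _⊢_⇓_ (ν : State) : PyExpr → ℝ → Set where
    evLit : ∀ {z} → ν ⊢ pyLit z ⇓ z
    evVar : ∀ {x} → ν ⊢ pyVar x ⇓ ν x
    evNeg : ∀ {e a} → ν ⊢ e ⇓ a → ν ⊢ pyNeg e ⇓ neg a
    evAdd : ∀ {e e′ a b} → ν ⊢ e ⇓ a → ν ⊢ e′ ⇓ b → ν ⊢ pyAdd e e′ ⇓ add a b
    evSub : ∀ {e e′ a b} → ν ⊢ e ⇓ a → ν ⊢ e′ ⇓ b → ν ⊢ pySub e e′ ⇓ sub a b
    evMul : ∀ {e e′ a b} → ν ⊢ e ⇓ a → ν ⊢ e′ ⇓ b → ν ⊢ pyMul e e′ ⇓ mul a b
    evDiv : ∀ {e e′ a b} → ν ⊢ e ⇓ a → ν ⊢ e′ ⇓ b → ν ⊢ pyDiv e e′ ⇓ div a b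
    evPow : ∀ {e e′ a b} → ν ⊢ e ⇓ a → ν ⊢ e′ ⇓ b → ν ⊢ pyPow e e′ ⇓ pow a b

-- The compiled expression evaluates to the term's value, and Python evaluation
-- is deterministic; together they force every value of Py θ to be ⟦ θ ⟧ ν.

module Submission where

open import Defs
open import Relation.Binary.PropositionalEquality using (_≡_; refl; cong; cong₂)

module _ (R : RealArith) where
  open RealArith R

  ⇓-deterministic : ∀ {ν e a b} → _⊢_⇓_ R ν e a → _⊢_⇓_ R ν e b → a ≡ b
  ⇓-deterministic evLit       evLit         = refl
  ⇓-deterministic evVar       evVar         = refl
  ⇓-deterministic (evNeg d)   (evNeg d′)    = cong neg (⇓-deterministic d d′)
  ⇓-deterministic (evAdd d e) (evAdd d′ e′) = cong₂ add (⇓-deterministic d d′) (⇓-deterministic e e′)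
  ⇓-deterministic (evSub d e) (evSub d′ e′) = cong₂ sub (⇓-deterministic d d′) (⇓-deterministic e e′)
  ⇓-deterministic (evMul d e) (evMul d′ e′) = cong₂ mul (⇓-deterministic d d′) (⇓-deterministic e e′)
  ⇓-deterministic (evDiv d e) (evDiv d′ e′) = cong₂ div (⇓-deterministic d d′) (⇓-deterministic e e′)
  ⇓-deterministic (evPow d e) (evPow d′ e′) = cong₂ pow (⇓-deterministic d d′) (⇓-deterministic e e′)

  Py-⇓-⟦⟧ : ∀ θ ν → _⊢_⇓_ R ν (Py R θ) (⟦_⟧_ R θ ν)
  Py-⇓-⟦⟧ (lit z)  ν = evLit
  Py-⇓-⟦⟧ (var x)  ν = evVar
  Py-⇓-⟦⟧ (⊖ θ)    ν = evNeg (Py-⇓-⟦⟧ θ ν)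
  Py-⇓-⟦⟧ (θ ⊕ η)  ν = evAdd (Py-⇓-⟦⟧ θ ν) (Py-⇓-⟦⟧ η ν)
  Py-⇓-⟦⟧ (θ ⊝ η)  ν = evSub (Py-⇓-⟦⟧ θ ν) (Py-⇓-⟦⟧ η ν)
  Py-⇓-⟦⟧ (θ ⊛ η)  ν = evMul (Py-⇓-⟦⟧ θ ν) (Py-⇓-⟦⟧ η ν)
  Py-⇓-⟦⟧ (θ ⊘ η)  ν = evDiv (Py-⇓-⟦⟧ θ ν) (Py-⇓-⟦⟧ η ν)
  Py-⇓-⟦⟧ (θ ^ᵗ η) ν = evPow (Py-⇓-⟦⟧ θ ν) (Py-⇓-⟦⟧ η ν)

lemma1 : (R : RealArith) → (θ : Term R) → (ν : State R) → (u : RealArith.ℝ R) →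
    _⊢_⇓_ R ν (Py R θ) u → (⟦_⟧_ R θ ν) ≡ u
lemma1 R θ ν u Pyθ⇓u = ⇓-deterministic R (Py-⇓-⟦⟧ R θ ν) Pyθ⇓u
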